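{- Let $n$ nodes observe integer-valued streams, node $i$ observing $v_i^t$ at time $t$, with all values pairwise distinct at every time, and fix $1\le k\le n$. Let $t'\le t''$ be times and suppose that one fixed $n$-tuple of intervals $(F_1,\dots,F_n)$ is a set of filters at every time $t\in[t',t'']$, with $v_i^t\in F_i$ for all $i$ and all $t\in[t',t'']$ (as is the case when an offline filter-based algorithm uses the same set of filters throughout $[t',t'']$). Then the top-$k$ set $S$ is the same at all times in $[t',t'']$, and \[T^+(t',t'')\ \ge\ T^-(t',t''),\] where $T^+(t',t'')=\min_{t'\le t\le t''}\min_{i\in S} v_i^t$ and $T^-(t',t'')=\max_{t'\le t\le t''}\max_{i\notin S} v_i^t$.
   Context: The top-$k$ set at time $t$ is the set of $k$ nodes holding the $k$ largest values among $v_1^t,\dots,v_n^t$. A set of filters at time $t$ is an $n$-tuple of intervals $F_i=[l_i,u_i]\subseteq\mathbb{N}\cup\{ -\infty,\infty\}$ with $v_i^t\in F_i$ such that, as long as every node's value stays within its own interval, the top-$k$ set does not change. -}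

module Defs where

open import Data.Nat using (ℕ; zero; suc; _+_; _∸_; _≤_; _<_; _≤ᵇ_)
open import Data.Bool using (if_then_else_)
open import Data.Fin using (Fin)
open import Data.Fin.Subset using (Subset; _∈_; _∉_; ∣_∣)
open import Data.List using (List; []; _∷_; map; foldr; upTo; allFin; concatMap; filter)
open import Data.Fin.Subset.Properties using (_∈?_)
open import Relation.Nullary.Decidable using (¬?)
open import Data.Product using (_×_)
open import Relation.Binary.PropositionalEquality using (_≡_)
open import Function.Definitions using (Injective)

-- ℕ ∪ {-∞, +∞}: endpoints of filter intervals
data Ext : Set where
  -∞  : Ext
  fin : ℕ → Ext
  +∞  : Ext

data _≤ₑ_ : Ext → Ext → Set where
  -∞≤   : ∀ {x} → -∞ ≤ₑ x
  ≤+∞   : ∀ {x} → x ≤ₑ +∞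
  fin≤  : ∀ {a b} → a ≤ b → fin a ≤ₑ fin b

_≤ₑᵇ_ : Ext → Ext → Data.Bool.Bool
-∞    ≤ₑᵇ _     = Data.Bool.true
_     ≤ₑᵇ +∞    = Data.Bool.true
fin a ≤ₑᵇ fin b = a ≤ᵇ b
_     ≤ₑᵇ _     = Data.Bool.false

minₑ maxₑ : Ext → Ext → Ext
minₑ x y = if x ≤ₑᵇ y then x else y
maxₑ x y = if x ≤ₑᵇ y then y else x

minimumₑ maximumₑ : List Ext → Ext
minimumₑ = foldr minₑ +∞
maximumₑ = foldr maxₑ -∞

Interval : Set
Interval = Ext × Ext

_∈I_ : ℕ → Interval → Set
x ∈I (l Data.Product., u) = (l ≤ₑ fin x) × (fin x ≤ₑ u)

Values : ℕ → Set
Values n = Fin n → ℕ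

Stream : ℕ → Set
Stream n = ℕ → Values n

IsTopK : ∀ {n} → ℕ → Values n → Subset n → Set
IsTopK k w S = (∣ S ∣ ≡ k) × (∀ i j → i ∈ S → j ∉ S → w j < w i)

-- F is a set of filters for the values w (with parameter k):
-- every w i lies in F i, and whenever values w' (pairwise distinct, per the
-- standing assumption) stay in their intervals, the top-k set is unchanged.
IsFilterSet : ∀ {n} → ℕ → (Fin n → Interval) → Values n → Set
IsFilterSet {n} k F w =
  (∀ i → w i ∈I F i) ×
  (∀ (w' : Values n) → Injective _≡_ _≡_ w' → (∀ i → w' i ∈I F i) →
     ∀ S → IsTopK k w S → IsTopK k w' S)

timeRange : ℕ → ℕ → List ℕ
timeRange t₁ t₂ = map (t₁ +_) (upTo (suc (t₂ ∸ t₁)))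

T⁺ : ∀ {n} → Stream n → Subset n → ℕ → ℕ → Ext
T⁺ v S t₁ t₂ =
  minimumₑ (concatMap (λ t → map (λ i → fin (v t i)) (filter (_∈? S) (allFin _)))
                      (timeRange t₁ t₂))

T⁻ : ∀ {n} → Stream n → Subset n → ℕ → ℕ → Ext
T⁻ v S t₁ t₂ =
  maximumₑ (concatMap (λ t → map (λ i → fin (v t i)) (filter (λ i → ¬? (i ∈? S)) (allFin _)))
                      (timeRange t₁ t₂))

module Submission where

-- Let S be a top-k set of the values at time t'.  Since the
-- filters F are valid at t', the filter property transports S to every time
-- in [t',t''].  For the inequality T⁻ ≤ T⁺ it suffices to compare single
-- readings: for times t , t° in the window, i ∈ S and j ∉ S, we show
-- v t j ≤ v t° i.  If instead v t° i < v t j, splice the two snapshots: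
-- i and the nodes outside S other than j keep their time-t° value, all other
-- nodes take their time-t value.  The spliced vector is injective (the first
-- group lies below v t° i, the second above v t j) and respects F, so by the
-- filter property at t° it still has top-k set S, forcing v t j < v t° i.

open import Defs
open import Data.Nat using (ℕ; zero; suc; _+_; _≤_; _<_; _⊔_; z≤n; s≤s)
open import Data.Nat.Properties
open import Data.Fin using (Fin; zero; suc) renaming (_≟_ to _≟ᶠ_)
open import Data.Fin.Properties using (any?)
open import Data.Fin.Subset using (Subset; _∈_; _∉_; _⊆_; _∪_; ∣_∣; ⁅_⁆; ⊤; ⊥; inside; outside)
open import Data.Fin.Subset.Properties
  using (_∈?_; p⊆q⇒∣p∣≤∣q∣; ∣⊤∣≡n; ∣⊥∣≡0; ∣⁅x⁆∣≡1; x∈⁅x⁆; x∈p∪q⁺)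
open import Data.Bool using (true; false)
open import Data.Product using (_×_; _,_; proj₂; Σ-syntax; ∃-syntax)
open import Data.Sum using (_⊎_; inj₁; inj₂)
open import Data.List using (List; []; _∷_; map; filter; concatMap; allFin)
open import Data.List.Membership.Propositional using (find) renaming (_∈_ to _∈ₗ_)
open import Data.List.Membership.Propositional.Properties using (∈-concatMap⁻; ∈-map⁻; ∈-filter⁻; ∈-upTo⁻)
open import Data.List.Relation.Unary.Any using (here; there)
open import Data.Vec using (tabulate; []; _∷_)
open import Data.Vec.Properties using (lookup∘tabulate; []=⇒lookup; lookup⇒[]=)
open import Function using (_∘_)
open import Function.Definitions using (Injective)
open import Relation.Binary.PropositionalEquality using (_≡_; _≢_; refl; sym; trans; cong; subst; subst₂)
open import Relation.Nullary using (yes; no; ¬_; does; contradiction)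
open import Relation.Nullary.Decidable using (¬?; _⊎-dec_; _×-dec_; dec-true)
open import Relation.Unary using (Pred; Decidable)
open import Level using (0ℓ)

minₑ-greatest : ∀ {x a b} → x ≤ₑ a → x ≤ₑ b → x ≤ₑ minₑ a b
minₑ-greatest {a = a} {b} x≤a x≤b with a ≤ₑᵇ b
... | true  = x≤a
... | false = x≤b

maxₑ-least : ∀ {x a b} → a ≤ₑ x → b ≤ₑ x → maxₑ a b ≤ₑ x
maxₑ-least {a = a} {b} a≤x b≤x with a ≤ₑᵇ b
... | true  = b≤x
... | false = a≤x

minimumₑ-greatest : ∀ c (ys : List Ext) → (∀ {y} → y ∈ₗ ys → c ≤ₑ y) → c ≤ₑ minimumₑ ys
minimumₑ-greatest c []       below = ≤+∞
minimumₑ-greatest c (y ∷ ys) below =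
  minₑ-greatest (below (here refl)) (minimumₑ-greatest c ys (below ∘ there))

maximumₑ-least : ∀ c (xs : List Ext) → (∀ {x} → x ∈ₗ xs → x ≤ₑ c) → maximumₑ xs ≤ₑ c
maximumₑ-least c []       above = -∞≤
maximumₑ-least c (x ∷ xs) above =
  maxₑ-least (above (here refl)) (maximumₑ-least c xs (above ∘ there))

maximumₑ≤minimumₑ : ∀ (xs ys : List Ext) →
  (∀ {x y} → x ∈ₗ xs → y ∈ₗ ys → x ≤ₑ y) → maximumₑ xs ≤ₑ minimumₑ ys
maximumₑ≤minimumₑ xs ys below =
  minimumₑ-greatest _ ys λ y∈ → maximumₑ-least _ xs λ x∈ → below x∈ y∈

∈-timeRange⁻ : ∀ {t₁ t₂ t} → t₁ ≤ t₂ → t ∈ₗ timeRange t₁ t₂ → t₁ ≤ t × t ≤ t₂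
∈-timeRange⁻ {t₁} {t₂} t₁≤t₂ t∈ with ∈-map⁻ (t₁ +_) t∈
... | d , d∈ , refl =
  m≤m+n t₁ d ,
  ≤-trans (+-monoʳ-≤ t₁ (≤-pred (∈-upTo⁻ d∈))) (≤-reflexive (m+[n∸m]≡n t₁≤t₂))

-- The list of readings  fin (v t j)  over times t ∈ [t₁,t₂] and nodes j
-- satisfying Q; T⁺ and T⁻ are its minimum resp. maximum for Q = (∈ S), (∉ S).
readings : ∀ {n} {Q : Pred (Fin n) 0ℓ} → Decidable Q → Stream n → ℕ → ℕ → List Ext
readings {n} Q? v t₁ t₂ =
  concatMap (λ t → map (λ j → fin (v t j)) (filter Q? (allFin n))) (timeRange t₁ t₂)

∈-readings⁻ : ∀ {n} {Q : Pred (Fin n) 0ℓ} (Q? : Decidable Q) (v : Stream n) {t₁ t₂ x} →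
  t₁ ≤ t₂ → x ∈ₗ readings Q? v t₁ t₂ →
  Σ[ t ∈ ℕ ] Σ[ j ∈ Fin n ] (t₁ ≤ t × t ≤ t₂ × Q j × x ≡ fin (v t j))
∈-readings⁻ Q? v {t₁} {t₂} t₁≤t₂ x∈ with find (∈-concatMap⁻ _ {xs = timeRange t₁ t₂} x∈)
... | t , t∈ , x∈ₜ with ∈-map⁻ _ x∈ₜ
... | j , j∈ , refl =
  let t₁≤t , t≤t₂ = ∈-timeRange⁻ t₁≤t₂ t∈
  in  t , j , t₁≤t , t≤t₂ , proj₂ (∈-filter⁻ Q? {xs = allFin _} j∈) , refl

select : ∀ {n} {P : Pred (Fin n) 0ℓ} → Decidable P → Subset n
select P? = tabulate (does ∘ P?)

∈-select⁺ : ∀ {n} {P : Pred (Fin n) 0ℓ} (P? : Decidable P) {m} → P m → m ∈ select P?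
∈-select⁺ P? {m} p = lookup⇒[]= m _ (trans (lookup∘tabulate (does ∘ P?) m) (dec-true (P? m) p))

∈-select⁻ : ∀ {n} {P : Pred (Fin n) 0ℓ} (P? : Decidable P) {m} → m ∈ select P? → P m
∈-select⁻ P? {m} m∈ with P? m | trans (sym (lookup∘tabulate (does ∘ P?) m)) ([]=⇒lookup m∈)
... | yes p | _ = p
... | no _  | ()

∣p∪q∣≤∣p∣+∣q∣ : ∀ {n} (p q : Subset n) → ∣ p ∪ q ∣ ≤ ∣ p ∣ + ∣ q ∣
∣p∪q∣≤∣p∣+∣q∣ []            []            = z≤n
∣p∪q∣≤∣p∣+∣q∣ (outside ∷ p) (outside ∷ q) = ∣p∪q∣≤∣p∣+∣q∣ p q
∣p∪q∣≤∣p∣+∣q∣ (outside ∷ p) (inside ∷ q)  =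
  ≤-trans (s≤s (∣p∪q∣≤∣p∣+∣q∣ p q)) (≤-reflexive (sym (+-suc ∣ p ∣ ∣ q ∣)))
∣p∪q∣≤∣p∣+∣q∣ (inside ∷ p)  (outside ∷ q) = s≤s (∣p∪q∣≤∣p∣+∣q∣ p q)
∣p∪q∣≤∣p∣+∣q∣ (inside ∷ p)  (inside ∷ q)  =
  s≤s (≤-trans (∣p∪q∣≤∣p∣+∣q∣ p q) (+-monoʳ-≤ ∣ p ∣ (n≤1+n ∣ q ∣)))

threshold : ∀ {n} → Values n → ℕ → Subset n
threshold w θ = select (λ m → θ ≤? w m)

threshold-separates : ∀ {n} (w : Values n) θ i j →
  i ∈ threshold w θ → j ∉ threshold w θ → w j < w i
threshold-separates w θ i j i∈ j∉ =
  <-≤-trans (≰⇒> (j∉ ∘ ∈-select⁺ (λ m → θ ≤? w m))) (∈-select⁻ (λ m → θ ≤? w m) i∈)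

-- Raising the threshold by one drops at most the (unique) node of value θ.
threshold-step : ∀ {n} (w : Values n) → Injective _≡_ _≡_ w → ∀ θ →
  ∣ threshold w θ ∣ ≤ suc ∣ threshold w (suc θ) ∣
threshold-step w inj θ with any? (λ m → w m ≟ θ)
... | yes (x , wx≡θ) = begin
    ∣ threshold w θ ∣                            ≤⟨ p⊆q⇒∣p∣≤∣q∣ (x∈p∪q⁺ ∘ split) ⟩
    ∣ ⁅ x ⁆ ∪ threshold w (suc θ) ∣              ≤⟨ ∣p∪q∣≤∣p∣+∣q∣ ⁅ x ⁆ _ ⟩
    ∣ ⁅ x ⁆ ∣ + ∣ threshold w (suc θ) ∣          ≡⟨ cong (_+ _) (∣⁅x⁆∣≡1 x) ⟩
    suc ∣ threshold w (suc θ) ∣                  ∎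
  where
  open ≤-Reasoning
  split : ∀ {m} → m ∈ threshold w θ → m ∈ ⁅ x ⁆ ⊎ m ∈ threshold w (suc θ)
  split {m} m∈ with w m ≟ θ
  ... | yes wm≡θ = inj₁ (subst (_∈ ⁅ x ⁆) (sym (inj (trans wm≡θ (sym wx≡θ)))) (x∈⁅x⁆ x))
  ... | no wm≢θ  = inj₂ (∈-select⁺ (λ m → suc θ ≤? w m)
                          (≤∧≢⇒< (∈-select⁻ (λ m → θ ≤? w m) m∈) (wm≢θ ∘ sym)))
... | no none = ≤-trans (p⊆q⇒∣p∣≤∣q∣ raise) (n≤1+n _)
  where
  raise : threshold w θ ⊆ threshold w (suc θ)
  raise {m} m∈ = ∈-select⁺ (λ m → suc θ ≤? w m)
                   (≤∧≢⇒< (∈-select⁻ (λ m → θ ≤? w m) m∈) (λ θ≡wm → none (m , sym θ≡wm)))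

threshold-zero : ∀ {n} (w : Values n) → n ≤ ∣ threshold w 0 ∣
threshold-zero {n} w = begin
  n                   ≡⟨ sym (∣⊤∣≡n n) ⟩
  ∣ ⊤ {n} ∣           ≤⟨ p⊆q⇒∣p∣≤∣q∣ {p = ⊤} (λ _ → ∈-select⁺ (λ m → 0 ≤? w m) z≤n) ⟩
  ∣ threshold w 0 ∣   ∎
  where open ≤-Reasoning

threshold-above : ∀ {n} (w : Values n) N → (∀ m → w m < N) → ∣ threshold w N ∣ ≡ 0
threshold-above {n} w N below = n≤0⇒n≡0 (begin
  ∣ threshold w N ∣   ≤⟨ p⊆q⇒∣p∣≤∣q∣ empty ⟩
  ∣ ⊥ {n} ∣           ≡⟨ ∣⊥∣≡0 n ⟩
  0                   ∎)
  where
  open ≤-Reasoning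
  empty : threshold w N ⊆ ⊥
  empty {m} m∈ = contradiction (∈-select⁻ (λ m → N ≤? w m) m∈) (<⇒≱ (below m))

strictUpperBound : ∀ {n} (w : Values n) → ∃[ N ] (∀ m → w m < N)
strictUpperBound {zero}  w = 0 , λ ()
strictUpperBound {suc n} w with strictUpperBound (w ∘ suc)
... | N , below = suc (w zero) ⊔ N , λ
  { zero    → m≤m⊔n (suc (w zero)) N
  ; (suc m) → <-≤-trans (below m) (m≤n⊔m (suc (w zero)) N) }

intermediate-value : (g : ℕ → ℕ) → (∀ θ → g θ ≤ suc (g (suc θ))) →
  ∀ {k} N → k ≤ g 0 → g N < k → ∃[ θ ] (g θ ≡ k)
intermediate-value g step zero    k≤g0 gN<k = contradiction k≤g0 (<⇒≱ gN<k)
intermediate-value g step {k} (suc N) k≤g0 gN+1<k with g N <? k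
... | yes gN<k = intermediate-value g step N k≤g0 gN<k
... | no gN≮k  = N , ≤-antisym (≤-trans (step N) gN+1<k) (≮⇒≥ gN≮k)

-- Injective values have a top-k set for every 1 ≤ k ≤ n: the threshold set
-- sizes fall from n (at θ = 0) to 0 (above all values) one step at a time.
topK-exists : ∀ {n} k → 1 ≤ k → k ≤ n → (w : Values n) → Injective _≡_ _≡_ w →
  Σ[ S ∈ Subset n ] IsTopK k w S
topK-exists k 1≤k k≤n w inj with strictUpperBound w
... | N , below with intermediate-value (λ θ → ∣ threshold w θ ∣) (threshold-step w inj) N
                       (≤-trans k≤n (threshold-zero w))
                       (subst (_< k) (sym (threshold-above w N below)) 1≤k)
... | θ , size≡k = threshold w θ , size≡k , threshold-separates w θ

module Splice {n : ℕ} {P : Pred (Fin n) 0ℓ} (P? : Decidable P) (u w : Values n) where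

  splice : Values n
  splice m with P? m
  ... | yes _ = u m
  ... | no _  = w m

  splice-yes : ∀ {m} → P m → splice m ≡ u m
  splice-yes {m} p with P? m
  ... | yes _ = refl
  ... | no ¬p = contradiction p ¬p

  splice-no : ∀ {m} → ¬ P m → splice m ≡ w m
  splice-no {m} ¬p with P? m
  ... | yes p = contradiction p ¬p
  ... | no _  = refl

  splice-∈F : ∀ (F : Fin n → Interval) → (∀ m → u m ∈I F m) → (∀ m → w m ∈I F m) →
    ∀ m → splice m ∈I F m
  splice-∈F F uF wF m with P? m
  ... | yes _ = uF m
  ... | no _  = wF m

  splice-injective : Injective _≡_ _≡_ u → Injective _≡_ _≡_ w →
    (∀ {m m'} → P m → ¬ P m' → u m < w m') → Injective _≡_ _≡_ splice
  splice-injective uinj winj below {m} {m'} eq with P? m | P? m'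
  ... | yes _ | yes _  = uinj eq
  ... | no _  | no _   = winj eq
  ... | yes p | no ¬p' = contradiction eq (<⇒≢ (below p ¬p'))
  ... | no ¬p | yes p' = contradiction (sym eq) (<⇒≢ (below p' ¬p))

crossSeparation : ∀ {n k} (F : Fin n → Interval) (u w : Values n) (S : Subset n) →
  IsFilterSet k F u → Injective _≡_ _≡_ u → Injective _≡_ _≡_ w → (∀ m → w m ∈I F m) →
  IsTopK k u S → ∀ {i j} → i ∈ S → j ∉ S → w j ≤ u i
crossSeparation {n} F u w S (uF , keepsTopK) uinj winj wF topU {i} {j} i∈S j∉S
  with w j ≤? u i
... | yes wj≤ui = wj≤ui
... | no wj≰ui  = contradiction wj<ui (<⇒≯ ui<wj)
  where
  ui<wj : u i < w j
  ui<wj = ≰⇒> wj≰ui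

  topW : IsTopK _ w S
  topW = keepsTopK w winj wF S topU

  P : Pred (Fin n) 0ℓ
  P m = m ≡ i ⊎ (m ∉ S × m ≢ j)

  P? : Decidable P
  P? m = (m ≟ᶠ i) ⊎-dec (¬? (m ∈? S) ×-dec ¬? (m ≟ᶠ j))

  open Splice P? u w

  u-low : ∀ {m} → P m → u m ≤ u i
  u-low (inj₁ refl)      = ≤-refl
  u-low (inj₂ (m∉S , _)) = <⇒≤ (proj₂ topU i _ i∈S m∉S)

  w-high : ∀ {m} → ¬ P m → w j ≤ w m
  w-high {m} ¬p with m ≟ᶠ j | m ∈? S
  ... | yes refl | _       = ≤-refl
  ... | no m≢j   | yes m∈S = <⇒≤ (proj₂ topW m j m∈S j∉S)
  ... | no m≢j   | no m∉S  = contradiction (inj₂ (m∉S , m≢j)) ¬p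

  ¬Pj : ¬ P j
  ¬Pj (inj₁ refl)      = j∉S i∈S
  ¬Pj (inj₂ (_ , j≢j)) = j≢j refl

  -- the splice stays in F and is injective, so S is still its top-k set
  topSplice : IsTopK _ splice S
  topSplice = keepsTopK splice
    (splice-injective uinj winj λ p ¬p' → ≤-<-trans (u-low p) (<-≤-trans ui<wj (w-high ¬p')))
    (splice-∈F F uF wF) S topU

  wj<ui : w j < u i
  wj<ui = subst₂ _<_ (splice-no ¬Pj) (splice-yes (inj₁ refl)) (proj₂ topSplice i j i∈S j∉S)

lemma2 : (n k : ℕ) → 1 ≤ k → k ≤ n →
    (v : Stream n) →
    (∀ t → Injective _≡_ _≡_ (v t)) →
    (t₁ t₂ : ℕ) → t₁ ≤ t₂ →
    (F : Fin n → Interval) →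
    (∀ t → t₁ ≤ t → t ≤ t₂ → IsFilterSet k F (v t)) →
    (∀ t → t₁ ≤ t → t ≤ t₂ → ∀ i → v t i ∈I F i) →
    Σ[ S ∈ Subset n ]
      ((∀ t → t₁ ≤ t → t ≤ t₂ → IsTopK k (v t) S) ×
       (T⁻ v S t₁ t₂ ≤ₑ T⁺ v S t₁ t₂))
lemma2 n k 1≤k k≤n v inj t₁ t₂ t₁≤t₂ F filters inF
  with topK-exists k 1≤k k≤n (v t₁) (inj t₁)
... | S , topS₁ = S , topS , maximumₑ≤minimumₑ _ _ separated
  where
  topS : ∀ t → t₁ ≤ t → t ≤ t₂ → IsTopK k (v t) S
  topS t t₁≤t t≤t₂ = proj₂ (filters t₁ ≤-refl t₁≤t₂) (v t) (inj t) (inF t t₁≤t t≤t₂) S topS₁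

  separated : ∀ {x y} → x ∈ₗ readings (λ j → ¬? (j ∈? S)) v t₁ t₂ →
    y ∈ₗ readings (_∈? S) v t₁ t₂ → x ≤ₑ y
  separated x∈ y∈ with ∈-readings⁻ _ v t₁≤t₂ x∈ | ∈-readings⁻ _ v t₁≤t₂ y∈
  ... | t , j , t₁≤t , t≤t₂ , j∉S , refl | t° , i , t₁≤t° , t°≤t₂ , i∈S , refl =
    fin≤ (crossSeparation F (v t°) (v t) S (filters t° t₁≤t° t°≤t₂) (inj t°) (inj t)
            (inF t t₁≤t t≤t₂) (topS t° t₁≤t° t°≤t₂) i∈S j∉S)
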